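{- Let $\mathcal F$ be a trunk controller and $\mathbb Q$ an $\mathcal F$-forcing notion which is weakly clear. (2) If $\mathcal F$ is semi-simple, then $\mathbb Q$, and even $(\mathbb Q,\le_{\mathrm{pr}})$, satisfies the $\aleph_2$-c.c. (3) If $\mathcal F$ is simple, then $\mathbb Q$, and even $(\mathbb Q,\le_{\mathrm{pr}})$, satisfies the regressive $\aleph_2$-c.c.
   Context: A trunk controller $\mathcal F$ is a set or class with three quasi-orders $\le$, $\le_{\mathrm{pr}}$, $\le_{\mathrm{apr}}$ such that $\le_{\mathrm{pr}}\subseteq\le$ and $\le_{\mathrm{apr}}\subseteq\le$, together with an auxiliary function $\mathrm{inter}_{\mathcal F}$. An $\mathcal F$-forcing notion is a tuple $\mathbb Q=(Q,\le,\le_{\mathrm{pr}},\le_{\mathrm{apr}},\mathrm{val})$ where $Q$ is a nonempty set, $\le,\le_{\mathrm{pr}},\le_{\mathrm{apr}}$ are quasi-orders on $Q$ with $\le_{\mathrm{pr}},\le_{\mathrm{apr}}\subseteq\le$, $\mathrm{val}:Q\to\mathcal F$ satisfies $p\le_x q\Rightarrow\mathrm{val}(p)\le^{\mathcal F}_x\mathrm{val}(q)$ for $x\in\{\text{usual},\mathrm{pr},\mathrm{apr}\}$, and if $p_0\le p_2$ then there is $p_1$ with $p_0\le_{\mathrm{pr}}p_1\le_{\mathrm{apr}}p_2$ and $\mathrm{val}(p_1)=\mathrm{inter}_{\mathcal F}(\mathrm{val}(p_0),\mathrm{val}(p_2))$. $\mathbb Q$ is weakly clear if whenever $p_0,p_1\in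 Q$ and $\mathrm{val}(p_0),\mathrm{val}(p_1)$ have a common $\le^{\mathcal F}_{\mathrm{pr}}$-upper bound, then $p_0,p_1$ have a common $\le_{\mathrm{pr}}$-upper bound. $\mathcal F$ is semi-simple if for any $y_\varepsilon\in\mathcal F$ ($\varepsilon<\omega_2$) there are $\varepsilon<\zeta<\omega_2$ such that $y_\varepsilon,y_\zeta$ have a common $\le_{\mathrm{pr}}$-upper bound. $\mathcal F$ is simple if for any $\langle y_\varepsilon:\varepsilon<\omega_2\rangle$ from $\mathcal F$ there are a club $E$ of $\omega_2$ and a pressing down (regressive) function $h$ on $E$ such that for any $\varepsilon<\zeta$ from $E$ of cofinality $\aleph_1$ with $h(\varepsilon)=h(\zeta)$, $y_\varepsilon,y_\zeta$ have a common $\le_{\mathrm{pr}}$-upper bound. A quasi-order satisfies the $\aleph_2$-c.c. if among any $\aleph_2$ elements some two have a common upper bound; it satisfies the regressive $\aleph_2$-c.c. if for every $\langle p_\varepsilon:\varepsilon<\omega_2\rangle$ there are a club $E\subseteq\omega_2$ and a regressive $h$ on $E$ such that $p_\varepsilon,p_\zeta$ have a common upper bound whenever $\varepsilon<\zeta$ are in $E$, of cofinality $\aleph_1$, and $h(\varepsilon)=h(\zeta)$. -}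

module Defs where

open import Level using (Level; _⊔_; suc)
open import Data.Product using (Σ; ∃; _×_; _,_)
open import Relation.Binary.PropositionalEquality using (_≡_)

record IsQuasiOrder {a r : Level} {A : Set a} (R : A → A → Set r) : Set (a ⊔ r) where
  field
    refl  : ∀ x → R x x
    trans : ∀ {x y z} → R x y → R y z → R x z

_⊆ᴿ_ : {a r s : Level} {A : Set a} → (A → A → Set r) → (A → A → Set s) → Set (a ⊔ r ⊔ s)
R ⊆ᴿ S = ∀ {x y} → R x y → S x y

CommonUB : {a r : Level} {A : Set a} → (A → A → Set r) → A → A → Set (a ⊔ r)
CommonUB {A = A} R x y = Σ A λ z → R x z × R y z

record TrunkController (ℓ : Level) : Set (suc ℓ) where
  field
    F     : Set ℓ
    _≤_   : F → F → Set ℓ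
    _≤pr_ : F → F → Set ℓ
    _≤apr_ : F → F → Set ℓ
    ≤-quasi    : IsQuasiOrder _≤_
    ≤pr-quasi  : IsQuasiOrder _≤pr_
    ≤apr-quasi : IsQuasiOrder _≤apr_
    pr⊆≤  : _≤pr_ ⊆ᴿ _≤_
    apr⊆≤ : _≤apr_ ⊆ᴿ _≤_
    inter : F → F → F

record ForcingNotion {ℓ : Level} (𝓕 : TrunkController ℓ) : Set (suc ℓ) where
  module T = TrunkController 𝓕
  field
    Q      : Set ℓ
    nonempty : Q
    _≤_    : Q → Q → Set ℓ
    _≤pr_  : Q → Q → Set ℓ
    _≤apr_ : Q → Q → Set ℓ
    ≤-quasi    : IsQuasiOrder _≤_
    ≤pr-quasi  : IsQuasiOrder _≤pr_
    ≤apr-quasi : IsQuasiOrder _≤apr_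
    pr⊆≤  : _≤pr_ ⊆ᴿ _≤_
    apr⊆≤ : _≤apr_ ⊆ᴿ _≤_
    val    : Q → T.F
    val-≤    : ∀ {p q} → p ≤ q → T._≤_ (val p) (val q)
    val-≤pr  : ∀ {p q} → p ≤pr q → T._≤pr_ (val p) (val q)
    val-≤apr : ∀ {p q} → p ≤apr q → T._≤apr_ (val p) (val q)
    interpolate : ∀ {p₀ p₂} → p₀ ≤ p₂ →
      Σ Q λ p₁ → (p₀ ≤pr p₁) × (p₁ ≤apr p₂) × (val p₁ ≡ T.inter (val p₀) (val p₂))


WeaklyClear : {ℓ : Level} {𝓕 : TrunkController ℓ} → ForcingNotion 𝓕 → Set ℓ
WeaklyClear {𝓕 = 𝓕} ℚ =
  ∀ p₀ p₁ → CommonUB (TrunkController._≤pr_ 𝓕) (val p₀) (val p₁) → CommonUB _≤pr_ p₀ p₁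
  where
    open ForcingNotion ℚ using (val; _≤pr_)

-- The stdlib has no
-- ordinals/cardinals, so ω₂ is supplied abstractly.
record Omega2 : Set₁ where
  field
    Ord        : Set
    _<_        : Ord → Ord → Set
    IsClub     : (Ord → Set) → Set
    CofAleph1  : Ord → Set

module _ (W : Omega2) where
  open Omega2 W

  Regressive : (E : Ord → Set) → ((ε : Ord) → E ε → Ord) → Set
  Regressive E h = ∀ ε (e : E ε) → h ε e < ε

  Aleph2cc : {a r : Level} {A : Set a} → (A → A → Set r) → Set (a ⊔ r)
  Aleph2cc {A = A} R = (p : Ord → A) → Σ Ord λ ε → Σ Ord λ ζ → (ε < ζ) × CommonUB R (p ε) (p ζ)

  RegAleph2cc : {a r : Level} {A : Set a} → (A → A → Set r) → Set (suc Level.zero ⊔ a ⊔ r)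
  RegAleph2cc {A = A} R = (p : Ord → A) →
    Σ (Ord → Set) λ E → IsClub E × Σ ((ε : Ord) → E ε → Ord) λ h → Regressive E h ×
      (∀ ε ζ (eε : E ε) (eζ : E ζ) → ε < ζ → CofAleph1 ε → CofAleph1 ζ →
         h ε eε ≡ h ζ eζ → CommonUB R (p ε) (p ζ))

  SemiSimple : {ℓ : Level} → TrunkController ℓ → Set ℓ
  SemiSimple 𝓕 = Aleph2cc (TrunkController._≤pr_ 𝓕)

  Simple : {ℓ : Level} → TrunkController ℓ → Set (suc Level.zero ⊔ ℓ)
  Simple 𝓕 = RegAleph2cc (TrunkController._≤pr_ 𝓕)

{-# OPTIONS --safe #-}
module Submission where

open import Defs
open import Level using (Level)
open import Function using (id)
open import Data.Product using (_×_; _,_)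

CommonUB-mono : ∀ {a r s} {A : Set a} {R : A → A → Set r} {S : A → A → Set s} →
                R ⊆ᴿ S → ∀ {x y} → CommonUB R x y → CommonUB S x y
CommonUB-mono R⊆S (z , xRz , yRz) = z , R⊆S xRz , R⊆S yRz

module _ (W : Omega2) {a b r s : Level} {A : Set a} {B : Set b}
         {R : A → A → Set r} {S : B → B → Set s} (f : A → B)
         (reflects : ∀ x y → CommonUB S (f x) (f y) → CommonUB R x y) where

  Aleph2cc-comap : Aleph2cc W S → Aleph2cc W R
  Aleph2cc-comap ccS p with ccS (λ ε → f (p ε))
  ... | ε , ζ , ε<ζ , ub = ε , ζ , ε<ζ , reflects (p ε) (p ζ) ub

  RegAleph2cc-comap : RegAleph2cc W S → RegAleph2cc W R
  RegAleph2cc-comap ccS p with ccS (λ ε → f (p ε))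
  ... | E , club , h , regressive , ub =
    E , club , h , regressive ,
    λ ε ζ eε eζ ε<ζ cofε cofζ hε≡hζ → reflects (p ε) (p ζ) (ub ε ζ eε eζ ε<ζ cofε cofζ hε≡hζ)

claim1p14 : (W : Omega2) {ℓ : Level} (𝓕 : TrunkController ℓ) (ℚ : ForcingNotion 𝓕) →
    WeaklyClear ℚ →
    (SemiSimple W 𝓕 → Aleph2cc W (ForcingNotion._≤_ ℚ) × Aleph2cc W (ForcingNotion._≤pr_ ℚ)) ×
    (Simple W 𝓕 → RegAleph2cc W (ForcingNotion._≤_ ℚ) × RegAleph2cc W (ForcingNotion._≤pr_ ℚ))
claim1p14 W 𝓕 ℚ weaklyClear = semiSimple , simple
  where
  open ForcingNotion ℚ

  prUB⇒UB : ∀ x y → CommonUB _≤pr_ x y → CommonUB _≤_ x y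
  prUB⇒UB _ _ = CommonUB-mono {R = _≤pr_} pr⊆≤

  semiSimple : SemiSimple W 𝓕 → Aleph2cc W _≤_ × Aleph2cc W _≤pr_
  semiSimple ccF = Aleph2cc-comap W id prUB⇒UB ccPr , ccPr
    where
    ccPr : Aleph2cc W _≤pr_
    ccPr = Aleph2cc-comap W {S = T._≤pr_} val weaklyClear ccF

  simple : Simple W 𝓕 → RegAleph2cc W _≤_ × RegAleph2cc W _≤pr_
  simple ccF = RegAleph2cc-comap W id prUB⇒UB ccPr , ccPr
    where
    ccPr : RegAleph2cc W _≤pr_
    ccPr = RegAleph2cc-comap W {S = T._≤pr_} val weaklyClear ccF
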